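{- Let $\mathbf u$ be an aperiodic infinite word over a finite alphabet whose language is closed under reversal, and let $N$ be an integer such that $T_{\mathbf u}(n)=0$ for all $n\ge N$. Then for every factor $w$ of $\mathbf u$ with $|w|\ge N$, the occurrences of $w$ and of $\overline{w}$ in $\mathbf u$ alternate; that is, if $w\neq\overline{w}$, then between any two occurrences $i<j$ of $w$ in $\mathbf u$ there is an occurrence $k$ of $\overline{w}$ with $i<k<j$, and between any two occurrences of $\overline{w}$ there is an occurrence of $w$.
   Context: An infinite word $\mathbf u=u_0u_1u_2\cdots$ is aperiodic if it is not eventually periodic. An occurrence of a factor $w$ in $\mathbf u$ is an index $i$ such that $w$ is a prefix of $u_iu_{i+1}\cdots$. For a finite word $w=w_0\cdots w_{n-1}$ its reversal is $\overline{w}=w_{n-1}\cdots w_0$; $w$ is a palindrome if $w=\overline{w}$. The language of $\mathbf u$ is closed under reversal if the reversal of every factor is a factor. $\mathcal C_{\mathbf u}(n)$ is the number of factors of length $n$, $\mathcal P_{\mathbf u}(n)$ the number of palindromic factors of length $n$, and $T_{\mathbf u}(n)=\mathcal C_{\mathbf u}(n+1)-\mathcal C_{\mathbf u}(n)+2-\mathcal P_{\mathbf u}(n+1)-\mathcal P_{\mathbf u}(n)$. -}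

module Defs where

open import Data.Nat using (ℕ; zero; suc; _+_; _≤_; _<_; _≥_)
open import Data.Fin using (Fin; toℕ)
open import Data.Vec using (Vec; lookup; reverse)
open import Data.List using (List; length)
open import Data.List.Membership.Propositional using (_∈_)
open import Data.List.Relation.Unary.Unique.Propositional using (Unique)
open import Data.Product using (Σ; ∃; _×_; _,_)
open import Relation.Binary.PropositionalEquality using (_≡_; _≢_)
open import Relation.Nullary using (¬_)
open import Function.Bundles using (_⇔_)

Word : ℕ → Set
Word k = ℕ → Fin k

EventuallyPeriodic : ∀ {k} → Word k → Set
EventuallyPeriodic u = Σ ℕ λ p → Σ ℕ λ n₀ → (0 < p) × (∀ i → n₀ ≤ i → u (i + p) ≡ u i)

Aperiodic : ∀ {k} → Word k → Set
Aperiodic u = ¬ EventuallyPeriodic u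

OccursAt : ∀ {k n} → Word k → Vec (Fin k) n → ℕ → Set
OccursAt u w i = ∀ t → u (i + toℕ t) ≡ lookup w t

Factor : ∀ {k n} → Word k → Vec (Fin k) n → Set
Factor u w = ∃ λ i → OccursAt u w i

Palindrome : ∀ {k n} → Vec (Fin k) n → Set
Palindrome w = reverse w ≡ w

ClosedUnderReversal : ∀ {k} → Word k → Set
ClosedUnderReversal {k} u = ∀ {n} (w : Vec (Fin k) n) → Factor u w → Factor u (reverse w)

CountIs : ∀ {k} (n : ℕ) → (Vec (Fin k) n → Set) → ℕ → Set
CountIs {k} n P c = Σ (List (Vec (Fin k) n)) λ l →
  Unique l × (∀ w → (w ∈ l) ⇔ P w) × length l ≡ c

ComplexityIs : ∀ {k} → Word k → ℕ → ℕ → Set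
ComplexityIs u n c = CountIs n (Factor u) c

PalComplexityIs : ∀ {k} → Word k → ℕ → ℕ → Set
PalComplexityIs u n c = CountIs n (λ w → Factor u w × Palindrome w) c

-- T_u(n) = C(n+1) - C(n) + 2 - P(n+1) - P(n) = 0, written over ℕ as
-- C(n+1) + 2 = C(n) + P(n+1) + P(n).
TZeroAt : ∀ {k} → Word k → ℕ → Set
TZeroAt u n = Σ ℕ λ c₀ → Σ ℕ λ c₁ → Σ ℕ λ p₀ → Σ ℕ λ p₁ →
  ComplexityIs u n c₀ × ComplexityIs u (suc n) c₁ ×
  PalComplexityIs u n p₀ × PalComplexityIs u (suc n) p₁ ×
  (c₁ + 2 ≡ c₀ + p₁ + p₀)

module Submission where

-- Fix n and consider subgraphs of the Rauzy graph of order n: a set of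
-- length-n factors ("vertices") closed under reversal, together with a
-- duplicate-free set of non-palindromic length-(n+1) factors ("edges"),
-- closed under reversal, whose suffixes are vertices.  Its weight is the
-- number of vertices plus the number of palindromic vertices.
--
--  * Counting (from T(n) = 0): a subgraph containing all length-n factors
--    has weight ≥ (number of edges) + 2, since C(n) + P(n) ≤ weight and
--    (edges) + P(n+1) ≤ C(n+1) = C(n) + P(n) + P(n+1) - 2.
--  * Growth: walking along u (forwards, or backwards using closure under
--    reversal) from a vertex of the subgraph, every new vertex y is added
--    together with the edge reaching it and their reversals; this raises
--    weight and edge count by the same amount 2.  Hence the difference
--    weight - edges never increases while we reach every factor.
--  * Alternation: if w occurs at i and at j > i with no occurrence of w or
--    of its reversal strictly in between, start from {w, reverse w}
--    (weight = edges + 2), walk from i to j - 1, and finally add the edge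
--    entering w at j, which is new.  This gives weight ≤ edges, and growing
--    to all factors contradicts the counting bound.

open import Defs
open import Data.Nat using (ℕ; zero; suc; _+_; _∸_; _≤_; _<_; _≥_; z≤n; s≤s; z<s; _≤?_; _≟_)
open import Data.Nat.Properties
open import Data.Fin using (Fin; toℕ; inject₁) renaming (zero to fzero; suc to fsuc)
open import Data.Fin.Properties using (toℕ-inject₁) renaming (_≟_ to _≟ᶠ_)
open import Data.Vec using (Vec; _∷_; reverse; tabulate; init; tail)
open import Data.Vec.Properties
  using (reverse-involutive; reverse-reverse; reverse-injective; init-reverse; tabulate-cong; tabulate∘lookup; lookup∘tabulate; ≡-dec)
open import Data.List using (List; []; _∷_; length; _++_)
open import Data.List.Properties using (length-++)
open import Data.List.Membership.Propositional using (_∈_; _∉_)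
open import Data.List.Membership.Propositional.Properties using (∈-∃++; ∈-++⁻)
open import Data.List.Relation.Unary.Any using (here; there)
open import Data.List.Relation.Unary.All using (_∷_) renaming (lookup to All-lookup)
open import Data.List.Relation.Unary.All.Properties using (¬Any⇒All¬)
open import Data.List.Relation.Unary.AllPairs using ([]; _∷_)
open import Data.List.Relation.Unary.Unique.Propositional using (Unique)
open import Data.List.Relation.Unary.Unique.Propositional.Properties using (++⁺)
open import Data.Product using (Σ; _×_; _,_; proj₁; proj₂)
open import Data.Sum using (_⊎_; inj₁; inj₂)
open import Data.Empty using (⊥; ⊥-elim)
open import Relation.Nullary using (¬_; Dec; yes; no)
open import Relation.Nullary.Decidable using (_⊎-dec_)
open import Relation.Binary.PropositionalEquality
open import Function.Bundles using (Equivalence)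

∈-delete : ∀ {A : Set} {y x : A} (as : List A) {bs : List A} →
  y ∈ as ++ x ∷ bs → y ≢ x → y ∈ as ++ bs
∈-delete []       (here y≡x) y≢x = ⊥-elim (y≢x y≡x)
∈-delete []       (there y∈) _   = y∈
∈-delete (a ∷ as) (here y≡a) _   = here y≡a
∈-delete (a ∷ as) (there y∈) y≢x = there (∈-delete as y∈ y≢x)

unique-⊆⇒length-≤ : ∀ {A : Set} {xs ys : List A} → Unique xs →
  (∀ {x} → x ∈ xs → x ∈ ys) → length xs ≤ length ys
unique-⊆⇒length-≤ {xs = []} _ _ = z≤n
unique-⊆⇒length-≤ {xs = x ∷ xs} {ys} (x∉xs ∷ uniq) xs⊆ys with ∈-∃++ (xs⊆ys (here refl))
... | as , bs , refl = begin
  suc (length xs)             ≤⟨ s≤s (unique-⊆⇒length-≤ uniq xs⊆as++bs) ⟩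
  suc (length (as ++ bs))     ≡⟨ cong suc (length-++ as) ⟩
  suc (length as + length bs) ≡⟨ +-suc (length as) (length bs) ⟨
  length as + length (x ∷ bs) ≡⟨ length-++ as ⟨
  length (as ++ x ∷ bs)       ∎
  where
  open ≤-Reasoning
  xs⊆as++bs : ∀ {y} → y ∈ xs → y ∈ as ++ bs
  xs⊆as++bs y∈ = ∈-delete as (xs⊆ys (there y∈)) (λ y≡x → All-lookup x∉xs y∈ (sym y≡x))

count-≤ : ∀ {k n} {P : Vec (Fin k) n → Set} {c} {ys : List (Vec (Fin k) n)} →
  CountIs n P c → (∀ {x} → P x → x ∈ ys) → c ≤ length ys
count-≤ (l , uniq , iff , refl) cover =
  unique-⊆⇒length-≤ uniq (λ x∈l → cover (Equivalence.to (iff _) x∈l))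

≤-count : ∀ {k n} {P : Vec (Fin k) n → Set} {c} {ys : List (Vec (Fin k) n)} →
  CountIs n P c → Unique ys → (∀ {x} → x ∈ ys → P x) → length ys ≤ c
≤-count (l , _ , iff , refl) uniq sound =
  unique-⊆⇒length-≤ uniq (λ x∈ys → Equivalence.from (iff _) (sound x∈ys))

lastSatisfying : (P : ℕ → Set) → (∀ m → Dec (P m)) → ∀ i d → P i →
  Σ ℕ λ m → i ≤ m × m ≤ i + d × P m × (∀ m' → m < m' → m' ≤ i + d → ¬ P m')
lastSatisfying P P? i zero Pi =
  i , ≤-refl , m≤m+n i 0 , Pi ,
  λ m' i<m' m'≤i+0 _ → <⇒≱ i<m' (≤-trans m'≤i+0 (≤-reflexive (+-identityʳ i)))
lastSatisfying P P? i (suc d) Pi with P? (i + suc d)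
... | yes P-end = i + suc d , m≤m+n i (suc d) , ≤-refl , P-end , λ m' lt le _ → <⇒≱ lt le
... | no ¬P-end with lastSatisfying P P? i d Pi
... | m , i≤m , m≤i+d , Pm , after = m , i≤m , ≤-trans m≤i+d (+-monoʳ-≤ i (n≤1+n d)) , Pm , after′
  where
  after′ : ∀ m' → m < m' → m' ≤ i + suc d → ¬ P m'
  after′ m' lt le with m' ≤? i + d
  ... | yes m'≤i+d = after m' lt m'≤i+d
  ... | no  m'≰i+d = λ Pm' → ¬P-end (subst P (≤-antisym le (≤-trans (≤-reflexive (+-suc i d)) (≰⇒> m'≰i+d))) Pm')

init-tabulate : ∀ {A : Set} {m} (f : Fin (suc m) → A) → init (tabulate f) ≡ tabulate (λ s → f (inject₁ s))
init-tabulate {m = zero}  f = refl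
init-tabulate {m = suc m} f = cong (f fzero ∷_) (init-tabulate (λ s → f (fsuc s)))

tail-reverse : ∀ {A : Set} {m} (e : Vec A (suc m)) → tail (reverse e) ≡ reverse (init e)
tail-reverse e = sym (reverse-reverse (begin
  reverse (tail (reverse e)) ≡⟨ init-reverse (reverse e) ⟨
  init (reverse (reverse e)) ≡⟨ cong init (reverse-involutive e) ⟩
  init e                     ∎))
  where open ≡-Reasoning

palindrome-tail : ∀ {A : Set} {m} {e : Vec A (suc m)} → reverse e ≡ e → tail e ≡ reverse (init e)
palindrome-tail {e = e} pal = trans (cong tail (sym pal)) (tail-reverse e)

reverse-reverse-∈ : ∀ {A : Set} {m} {x : Vec A m} {L : List (Vec A m)} → x ∈ L → reverse (reverse x) ∈ L
reverse-reverse-∈ {x = x} = subst (_∈ _) (sym (reverse-involutive x))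

module Rauzy {k : ℕ} (u : Word k) (closed : ClosedUnderReversal u) (n : ℕ) where

  V : Set
  V = Vec (Fin k) n

  E : Set
  E = Vec (Fin k) (suc n)

  _≟V_ : (x y : V) → Dec (x ≡ y)
  _≟V_ = ≡-dec _≟ᶠ_

  open import Data.List.Membership.DecPropositional _≟V_ using (_∈?_)

  factorAt : ∀ m → ℕ → Vec (Fin k) m
  factorAt m t = tabulate (λ s → u (t + toℕ s))

  vertexAt : ℕ → V
  vertexAt = factorAt n

  edgeAt : ℕ → E
  edgeAt = factorAt (suc n)

  occurs⇒factorAt : ∀ {m} {x : Vec (Fin k) m} {t} → OccursAt u x t → x ≡ factorAt m t
  occurs⇒factorAt {x = x} occ = trans (sym (tabulate∘lookup x)) (tabulate-cong (λ s → sym (occ s)))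

  factorAt⇒occurs : ∀ {m} {x : Vec (Fin k) m} {t} → x ≡ factorAt m t → OccursAt u x t
  factorAt⇒occurs refl s = sym (lookup∘tabulate _ s)

  edgeAt-factor : ∀ t → Factor u (edgeAt t)
  edgeAt-factor t = t , factorAt⇒occurs refl

  init-edgeAt : ∀ t → init (edgeAt t) ≡ vertexAt t
  init-edgeAt t = trans (init-tabulate (λ s → u (t + toℕ s)))
                        (tabulate-cong (λ s → cong (λ z → u (t + z)) (toℕ-inject₁ s)))

  tail-edgeAt : ∀ t → tail (edgeAt t) ≡ vertexAt (suc t)
  tail-edgeAt t = tabulate-cong (λ s → cong u (+-suc t (toℕ s)))

  init-reverse-edgeAt : ∀ t → init (reverse (edgeAt t)) ≡ reverse (vertexAt (suc t))
  init-reverse-edgeAt t = trans (init-reverse (edgeAt t)) (cong reverse (tail-edgeAt t))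

  tail-reverse-edgeAt : ∀ t → tail (reverse (edgeAt t)) ≡ reverse (vertexAt t)
  tail-reverse-edgeAt t = trans (tail-reverse (edgeAt t)) (cong reverse (init-edgeAt t))

  record Subgraph : Set where
    field
      vertices    : List V
      palindromes : List V
      edges       : List E
      vertices-reverse    : ∀ {x} → x ∈ vertices → reverse x ∈ vertices
      palindromes-include : ∀ {x} → x ∈ vertices → Palindrome x → x ∈ palindromes
      edges-tail          : ∀ {e} → e ∈ edges → tail e ∈ vertices
      edges-unique        : Unique edges
      edges-factor        : ∀ {e} → e ∈ edges → Factor u e
      edges-nonpalindrome : ∀ {e} → e ∈ edges → ¬ Palindrome e
      edges-reverse       : ∀ {e} → e ∈ edges → reverse e ∈ edges
  open Subgraph

  -- The reversed edge at t ends in the reversed vertex at t; as vertex sets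
  -- are closed under reversal, reaching its end means reaching the vertex at t.
  reversed-tail∈ : ∀ g {t} → tail (reverse (edgeAt t)) ∈ vertices g → vertexAt t ∈ vertices g
  reversed-tail∈ g {t} tail∈ =
    subst (_∈ vertices g) (trans (cong reverse (tail-reverse-edgeAt t)) (reverse-involutive (vertexAt t)))
          (vertices-reverse g tail∈)

  -- Vertices count once, palindromic ones twice; bounds C(n) + P(n) once all factors are vertices.
  weight : Subgraph → ℕ
  weight g = length (vertices g) + length (palindromes g)

  record Grows (g g' : Subgraph) : Set where
    constructor growing
    field
      vertices-⊆   : ∀ {x} → x ∈ vertices g → x ∈ vertices g'
      growth       : ℕ
      weight-grows : weight g' ≡ weight g + growth
      edges-grow   : length (edges g') ≡ length (edges g) + growth
  open Grows using (vertices-⊆)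

  grows-refl : ∀ g → Grows g g
  grows-refl g = growing (λ x∈ → x∈) 0 (sym (+-identityʳ _)) (sym (+-identityʳ _))

  grows-trans : ∀ {g₁ g₂ g₃} → Grows g₁ g₂ → Grows g₂ g₃ → Grows g₁ g₃
  grows-trans (growing sub₁ d₁ w₁ e₁) (growing sub₂ d₂ w₂ e₂) =
    growing (λ x∈ → sub₂ (sub₁ x∈)) (d₁ + d₂)
      (trans w₂ (trans (cong (_+ d₂) w₁) (+-assoc _ d₁ d₂)))
      (trans e₂ (trans (cong (_+ d₂) e₁) (+-assoc _ d₁ d₂)))

  grows-slack : ∀ {g g'} c → Grows g g' → weight g ≤ length (edges g) + c → weight g' ≤ length (edges g') + c
  grows-slack {g} {g'} c (growing _ d wt≡ len≡) bound = begin
    weight g'                  ≡⟨ wt≡ ⟩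
    weight g + d               ≤⟨ +-monoˡ-≤ d bound ⟩
    length (edges g) + c + d   ≡⟨ +-assoc (length (edges g)) c d ⟩
    length (edges g) + (c + d) ≡⟨ cong (length (edges g) +_) (+-comm c d) ⟩
    length (edges g) + (d + c) ≡⟨ +-assoc (length (edges g)) d c ⟨
    length (edges g) + d + c   ≡⟨ cong (_+ c) len≡ ⟨
    length (edges g') + c      ∎
    where open ≤-Reasoning

  -- Adding a new vertex y together with its reversal raises the weight by 2
  -- (a palindrome counts once as vertex and once as palindrome).
  addVertex : (g : Subgraph) (y : V) → y ∉ vertices g →
    Σ Subgraph λ g' → (∀ {x} → x ∈ vertices g → x ∈ vertices g') × y ∈ vertices g' ×
      edges g' ≡ edges g × weight g' ≡ weight g + 2
  addVertex g y y∉ with reverse y ≟V y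
  ... | yes pal = record
    { vertices = y ∷ vertices g ; palindromes = y ∷ palindromes g ; edges = edges g
    ; vertices-reverse = λ { (here refl) → here pal ; (there x∈) → there (vertices-reverse g x∈) }
    ; palindromes-include = λ { (here refl) _ → here refl ; (there x∈) p → there (palindromes-include g x∈ p) }
    ; edges-tail = λ e∈ → there (edges-tail g e∈)
    ; edges-unique = edges-unique g ; edges-factor = edges-factor g
    ; edges-nonpalindrome = edges-nonpalindrome g ; edges-reverse = edges-reverse g
    } , there , here refl , refl ,
    trans (cong suc (+-suc (length (vertices g)) (length (palindromes g)))) (+-comm 2 (weight g))
  ... | no ¬pal = record
    { vertices = y ∷ reverse y ∷ vertices g ; palindromes = palindromes g ; edges = edges g
    ; vertices-reverse = λ { (here refl) → there (here refl) ; (there (here refl)) → reverse-reverse-∈ (here refl)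
                           ; (there (there x∈)) → there (there (vertices-reverse g x∈)) }
    ; palindromes-include = λ { (here refl) p → ⊥-elim (¬pal p)
                              ; (there (here refl)) p → ⊥-elim (¬pal (reverse-injective p))
                              ; (there (there x∈)) p → palindromes-include g x∈ p }
    ; edges-tail = λ e∈ → there (there (edges-tail g e∈))
    ; edges-unique = edges-unique g ; edges-factor = edges-factor g
    ; edges-nonpalindrome = edges-nonpalindrome g ; edges-reverse = edges-reverse g
    } , (λ x∈ → there (there x∈)) , here refl , refl , +-comm 2 (weight g)

  addEdgePair : (g : Subgraph) (e : E) → Factor u e → init e ∈ vertices g → tail e ∈ vertices g →
    e ∉ edges g → ¬ Palindrome e → Subgraph
  addEdgePair g e e-factor init∈ tail∈ e∉ ¬pal = record
    { vertices = vertices g ; palindromes = palindromes g ; edges = e ∷ reverse e ∷ edges g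
    ; vertices-reverse = vertices-reverse g ; palindromes-include = palindromes-include g
    ; edges-tail = λ { (here refl) → tail∈
                     ; (there (here refl)) → subst (_∈ vertices g) (sym (tail-reverse e)) (vertices-reverse g init∈)
                     ; (there (there e∈)) → edges-tail g e∈ }
    ; edges-unique = ((λ e≡ē → ¬pal (sym e≡ē)) ∷ ¬Any⇒All¬ _ e∉)
                   ∷ (¬Any⇒All¬ _ (λ ē∈ → e∉ (subst (_∈ edges g) (reverse-involutive e) (edges-reverse g ē∈))))
                   ∷ edges-unique g
    ; edges-factor = λ { (here refl) → e-factor ; (there (here refl)) → closed e e-factor
                       ; (there (there e∈)) → edges-factor g e∈ }
    ; edges-nonpalindrome = λ { (here refl) → ¬pal
                              ; (there (here refl)) → λ p → ¬pal (reverse-injective p)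
                              ; (there (there e∈)) → edges-nonpalindrome g e∈ }
    ; edges-reverse = λ { (here refl) → there (here refl) ; (there (here refl)) → reverse-reverse-∈ (here refl)
                        ; (there (there e∈)) → there (there (edges-reverse g e∈)) }
    }

  extend : (g : Subgraph) (e : E) → Factor u e → init e ∈ vertices g → tail e ∉ vertices g →
    Σ Subgraph λ g' → Grows g g' × tail e ∈ vertices g' × edges g' ≡ e ∷ reverse e ∷ edges g
  extend g e e-factor init∈ tail∉ with addVertex g (tail e) tail∉
  ... | g₁ , sub , tail∈ , edges≡ , weight≡ =
    addEdgePair g₁ e e-factor (sub init∈) tail∈ e∉ ¬pal ,
    growing sub 2 weight≡ (trans (cong (λ es → 2 + length es) edges≡) (+-comm 2 (length (edges g)))) ,
    tail∈ , cong (λ es → e ∷ reverse e ∷ es) edges≡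
    where
    e∉ : e ∉ edges g₁
    e∉ e∈ = tail∉ (edges-tail g (subst (e ∈_) edges≡ e∈))
    ¬pal : ¬ Palindrome e
    ¬pal pal = tail∉ (subst (_∈ vertices g) (sym (palindrome-tail pal)) (vertices-reverse g init∈))

  stepForward : (g : Subgraph) (t : ℕ) → vertexAt t ∈ vertices g →
    Σ Subgraph λ g' → Grows g g' × vertexAt (suc t) ∈ vertices g' ×
      (edges g' ≡ edges g ⊎ edges g' ≡ edgeAt t ∷ reverse (edgeAt t) ∷ edges g)
  stepForward g t here∈ with vertexAt (suc t) ∈? vertices g
  ... | yes next∈ = g , grows-refl g , next∈ , inj₁ refl
  ... | no next∉ with extend g (edgeAt t) (edgeAt-factor t) (subst (_∈ vertices g) (sym (init-edgeAt t)) here∈)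
                            (λ tail∈ → next∉ (subst (_∈ vertices g) (tail-edgeAt t) tail∈))
  ... | g' , grows , tail∈ , edges≡ = g' , grows , subst (_∈ vertices g') (tail-edgeAt t) tail∈ , inj₂ edges≡

  stepBackward : (g : Subgraph) (t : ℕ) → vertexAt (suc t) ∈ vertices g →
    Σ Subgraph λ g' → Grows g g' × vertexAt t ∈ vertices g'
  stepBackward g t next∈ with vertexAt t ∈? vertices g
  ... | yes here∈ = g , grows-refl g , here∈
  ... | no here∉ with extend g (reverse (edgeAt t)) (closed (edgeAt t) (edgeAt-factor t))
                           (subst (_∈ vertices g) (sym (init-reverse-edgeAt t)) (vertices-reverse g next∈))
                           (λ tail∈ → here∉ (reversed-tail∈ g tail∈))
  ... | g' , grows , tail∈ , _ = g' , grows , reversed-tail∈ g' tail∈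

  walkForward : (g : Subgraph) (a d : ℕ) → vertexAt a ∈ vertices g →
    Σ Subgraph λ g' → Grows g g' × vertexAt (a + d) ∈ vertices g'
  walkForward g a zero a∈ = g , grows-refl g , subst (λ z → vertexAt z ∈ vertices g) (sym (+-identityʳ a)) a∈
  walkForward g a (suc d) a∈ with walkForward g a d a∈
  ... | g₁ , grows₁ , ad∈ with stepForward g₁ (a + d) ad∈
  ... | g₂ , grows₂ , next∈ , _ =
    g₂ , grows-trans grows₁ grows₂ , subst (λ z → vertexAt z ∈ vertices g₂) (sym (+-suc a d)) next∈

  walkToStart : (g : Subgraph) (a : ℕ) → vertexAt a ∈ vertices g →
    Σ Subgraph λ g' → Grows g g' × vertexAt 0 ∈ vertices g'
  walkToStart g zero a∈ = g , grows-refl g , a∈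
  walkToStart g (suc a) a∈ with stepBackward g a a∈
  ... | g₁ , grows₁ , prev∈ with walkToStart g₁ a prev∈
  ... | g₂ , grows₂ , 0∈ = g₂ , grows-trans grows₁ grows₂ , 0∈

  cover : (xs : List V) → (∀ {x} → x ∈ xs → Factor u x) → (g : Subgraph) → vertexAt 0 ∈ vertices g →
    Σ Subgraph λ g' → Grows g g' × (∀ {x} → x ∈ xs → x ∈ vertices g')
  cover [] _ g _ = g , grows-refl g , λ ()
  cover (x ∷ xs) factors g 0∈ with factors (here refl)
  ... | t , occ with walkForward g 0 t 0∈
  ... | g₁ , grows₁ , t∈ with cover xs (λ x∈ → factors (there x∈)) g₁ (vertices-⊆ grows₁ 0∈)
  ... | g₂ , grows₂ , xs⊆ = g₂ , grows-trans grows₁ grows₂ ,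
    λ { (here refl) → vertices-⊆ grows₂ (subst (_∈ vertices g₁) (sym (occurs⇒factorAt occ)) t∈) ; (there x∈) → xs⊆ x∈ }

  saturate : ∀ {c} → ComplexityIs u n c → (g : Subgraph) (a : ℕ) → vertexAt a ∈ vertices g →
    Σ Subgraph λ g' → Grows g g' × (∀ {x} → Factor u x → x ∈ vertices g')
  saturate (xs , _ , iff , _) g a a∈ with walkToStart g a a∈
  ... | g₁ , grows₁ , 0∈ with cover xs (λ x∈ → Equivalence.to (iff _) x∈) g₁ 0∈
  ... | g₂ , grows₂ , xs⊆ = g₂ , grows-trans grows₁ grows₂ , λ fx → xs⊆ (Equivalence.from (iff _) fx)

  edge-deficit : TZeroAt u n → (g : Subgraph) → (∀ {x} → Factor u x → x ∈ vertices g) →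
    length (edges g) + 2 ≤ weight g
  edge-deficit (c₀ , c₁ , p₀ , p₁ , C₀ , C₁ , P₀ , (pals₁ , pals-unique , pals-iff , refl) , T≡0) g all∈ =
    +-cancelʳ-≤ p₁ (length (edges g) + 2) (weight g) (begin
      length (edges g) + 2 + p₁   ≡⟨ +-assoc (length (edges g)) 2 p₁ ⟩
      length (edges g) + (2 + p₁) ≡⟨ cong (length (edges g) +_) (+-comm 2 p₁) ⟩
      length (edges g) + (p₁ + 2) ≡⟨ +-assoc (length (edges g)) p₁ 2 ⟨
      length (edges g) + p₁ + 2   ≤⟨ +-monoˡ-≤ 2 edges+pals≤c₁ ⟩
      c₁ + 2                      ≡⟨ T≡0 ⟩
      c₀ + p₁ + p₀                ≡⟨ +-assoc c₀ p₁ p₀ ⟩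
      c₀ + (p₁ + p₀)              ≡⟨ cong (c₀ +_) (+-comm p₁ p₀) ⟩
      c₀ + (p₀ + p₁)              ≡⟨ +-assoc c₀ p₀ p₁ ⟨
      c₀ + p₀ + p₁                ≤⟨ +-monoˡ-≤ p₁ (+-mono-≤ c₀≤ p₀≤) ⟩
      weight g + p₁               ∎)
    where
    open ≤-Reasoning
    c₀≤ : c₀ ≤ length (vertices g)
    c₀≤ = count-≤ C₀ all∈
    p₀≤ : p₀ ≤ length (palindromes g)
    p₀≤ = count-≤ P₀ (λ (fx , pal) → palindromes-include g (all∈ fx) pal)
    pal : ∀ {x} → x ∈ pals₁ → Factor u x × Palindrome x
    pal x∈ = Equivalence.to (pals-iff _) x∈
    disjoint : ∀ {x} → ¬ (x ∈ edges g × x ∈ pals₁)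
    disjoint (x∈edges , x∈pals) = edges-nonpalindrome g x∈edges (proj₂ (pal x∈pals))
    factor : ∀ {x} → x ∈ edges g ++ pals₁ → Factor u x
    factor x∈ with ∈-++⁻ (edges g) x∈
    ... | inj₁ x∈edges = edges-factor g x∈edges
    ... | inj₂ x∈pals  = proj₁ (pal x∈pals)
    edges+pals≤c₁ : length (edges g) + length pals₁ ≤ c₁
    edges+pals≤c₁ = subst (_≤ c₁) (length-++ (edges g))
                          (≤-count C₁ (++⁺ (edges-unique g) pals-unique disjoint) factor)

  no-tight-subgraph : TZeroAt u n → (g : Subgraph) (a : ℕ) → vertexAt a ∈ vertices g →
    ¬ (weight g ≤ length (edges g))
  no-tight-subgraph tzero@(_ , _ , _ , _ , C₀ , _) g a a∈ tight with saturate C₀ g a a∈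
  ... | g' , grows , all∈ = m+1+n≰m (length (edges g')) (≤-trans (edge-deficit tzero g' all∈) still-tight)
    where
    still-tight : weight g' ≤ length (edges g')
    still-tight = ≤-trans (grows-slack 0 grows (≤-trans tight (m≤m+n _ 0))) (≤-reflexive (+-identityʳ _))

  Hit : V → ℕ → Set
  Hit w m = vertexAt m ≡ w ⊎ vertexAt m ≡ reverse w

  hit? : ∀ w m → Dec (Hit w m)
  hit? w m = (vertexAt m ≟V w) ⊎-dec (vertexAt m ≟V reverse w)

  module Gap (w : V) (w≢w̅ : w ≢ reverse w) (i d : ℕ)
             (w-at-i : vertexAt i ≡ w) (w-at-end : vertexAt (suc (i + d)) ≡ w)
             (gap : ∀ m → i < m → m ≤ i + d → ¬ Hit w m) where

    -- The reversal of w occurs nowhere in [i, i + d] (at i because w is not a palindrome).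
    no-reverse : ∀ t → t ≤ d → vertexAt (i + t) ≢ reverse w
    no-reverse zero    _   at≡ = w≢w̅ (trans (sym w-at-i) (trans (cong vertexAt (sym (+-identityʳ i))) at≡))
    no-reverse (suc t) t≤d at≡ = gap (i + suc t) (m<m+n i z<s) (+-monoʳ-≤ i t≤d) (inj₂ at≡)

    AvoidsW : Subgraph → Set
    AvoidsW g = ∀ {e} → e ∈ edges g → tail e ≢ w

    crossed-avoid : ∀ t → suc t ≤ d → ∀ {e} → e ∈ edgeAt (i + t) ∷ reverse (edgeAt (i + t)) ∷ [] → tail e ≢ w
    crossed-avoid t t<d (here refl) tail≡w =
      gap (i + suc t) (m<m+n i z<s) (+-monoʳ-≤ i t<d)
          (inj₁ (trans (cong vertexAt (+-suc i t)) (trans (sym (tail-edgeAt (i + t))) tail≡w)))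
    crossed-avoid t t<d (there (here refl)) tail≡w =
      no-reverse t (≤-trans (n≤1+n t) t<d) (sym (reverse-reverse (trans (sym (tail-reverse-edgeAt (i + t))) tail≡w)))

    start : Subgraph
    start = record
      { vertices = w ∷ reverse w ∷ [] ; palindromes = [] ; edges = []
      ; vertices-reverse = λ { (here refl) → there (here refl) ; (there (here refl)) → reverse-reverse-∈ (here refl) }
      ; palindromes-include = λ { (here refl) p → ⊥-elim (w≢w̅ (sym p))
                                ; (there (here refl)) p → ⊥-elim (w≢w̅ (sym (reverse-injective p))) }
      ; edges-tail = λ () ; edges-unique = [] ; edges-factor = λ () ; edges-nonpalindrome = λ () ; edges-reverse = λ () }

    walk : ∀ t → t ≤ d → Σ Subgraph λ g →
      vertexAt (i + t) ∈ vertices g × w ∈ vertices g × weight g ≤ length (edges g) + 2 × AvoidsW g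
    walk zero _ = start , subst (_∈ vertices start) (sym (trans (cong vertexAt (+-identityʳ i)) w-at-i)) (here refl) ,
                  here refl , ≤-refl , λ ()
    walk (suc t) t<d with walk t (≤-trans (n≤1+n t) t<d)
    ... | g , at∈ , w∈ , slack , avoids with stepForward g (i + t) at∈
    ... | g' , grows , next∈ , new =
      g' , subst (λ z → vertexAt z ∈ vertices g') (sym (+-suc i t)) next∈ , vertices-⊆ grows w∈ ,
      grows-slack 2 grows slack , avoids′ new
      where
      avoids′ : (edges g' ≡ edges g ⊎ edges g' ≡ edgeAt (i + t) ∷ reverse (edgeAt (i + t)) ∷ edges g) → AvoidsW g'
      avoids′ (inj₁ same) e∈ = avoids (subst (_ ∈_) same e∈)
      avoids′ (inj₂ added) e∈ with subst (_ ∈_) added e∈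
      ... | here refl = crossed-avoid t t<d (here refl)
      ... | there (here refl) = crossed-avoid t t<d (there (here refl))
      ... | there (there old∈) = avoids old∈

    -- Closing the walk with the edge entering w at i + d + 1 makes the subgraph tight.
    impossible : TZeroAt u n → ⊥
    impossible tzero with walk d ≤-refl
    ... | g , last∈ , w∈ , slack , avoids =
      no-tight-subgraph tzero closed-g i w∈-start tight
      where
      e : E
      e = edgeAt (i + d)
      tail≡w : tail e ≡ w
      tail≡w = trans (tail-edgeAt (i + d)) w-at-end
      ¬pal : ¬ Palindrome e
      ¬pal pal = no-reverse d ≤-refl (sym (reverse-reverse reversed-last≡w))
        where
        reversed-last≡w : reverse (vertexAt (i + d)) ≡ w
        reversed-last≡w = trans (cong reverse (sym (init-edgeAt (i + d)))) (trans (sym (palindrome-tail pal)) tail≡w)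
      closed-g : Subgraph
      closed-g = addEdgePair g e (edgeAt-factor (i + d)) (subst (_∈ vertices g) (sym (init-edgeAt (i + d))) last∈)
                             (subst (_∈ vertices g) (sym tail≡w) w∈) (λ e∈ → avoids e∈ tail≡w) ¬pal
      w∈-start : vertexAt i ∈ vertices closed-g
      w∈-start = subst (_∈ vertices g) (sym w-at-i) w∈
      tight : weight closed-g ≤ length (edges closed-g)
      tight = ≤-trans slack (≤-reflexive (+-comm (length (edges g)) 2))

  reverse-between : TZeroAt u n → (w : V) → w ≢ reverse w →
    ∀ i j → i < j → OccursAt u w i → OccursAt u w j → Σ ℕ λ m → i < m × m < j × OccursAt u (reverse w) m
  reverse-between tzero w w≢w̅ i j i<j occ-i occ-j with m≤n⇒∃[o]m+o≡n i<j
  ... | d , refl with lastSatisfying (Hit w) (hit? w) i d (inj₁ w-at-i)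
    where
    w-at-i : vertexAt i ≡ w
    w-at-i = sym (occurs⇒factorAt occ-i)
  ... | m , i≤m , m≤i+d , inj₂ w̅-at-m , _ with m ≟ i
  ...   | yes refl = ⊥-elim (w≢w̅ (trans (occurs⇒factorAt occ-i) w̅-at-m))
  ...   | no  m≢i  = m , ≤∧≢⇒< i≤m (λ i≡m → m≢i (sym i≡m)) , s≤s m≤i+d , factorAt⇒occurs (sym w̅-at-m)
  reverse-between tzero w w≢w̅ i j i<j occ-i occ-j | d , refl | m , i≤m , m≤i+d , inj₁ w-at-m , after =
    ⊥-elim (Gap.impossible w w≢w̅ m ((i + d) ∸ m) w-at-m w-at-end gap tzero)
    where
    m+rest≡i+d : m + ((i + d) ∸ m) ≡ i + d
    m+rest≡i+d = m+[n∸m]≡n m≤i+d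
    w-at-end : vertexAt (suc (m + ((i + d) ∸ m))) ≡ w
    w-at-end = trans (cong (λ z → vertexAt (suc z)) m+rest≡i+d) (sym (occurs⇒factorAt occ-j))
    gap : ∀ m' → m < m' → m' ≤ m + ((i + d) ∸ m) → ¬ Hit w m'
    gap m' m<m' m'≤ = after m' m<m' (subst (m' ≤_) m+rest≡i+d m'≤)

  alternation : TZeroAt u n → (w : V) → w ≢ reverse w →
    (∀ i j → i < j → OccursAt u w i → OccursAt u w j → Σ ℕ λ m → i < m × m < j × OccursAt u (reverse w) m)
    × (∀ i j → i < j → OccursAt u (reverse w) i → OccursAt u (reverse w) j → Σ ℕ λ m → i < m × m < j × OccursAt u w m)
  alternation tzero w w≢w̅ = reverse-between tzero w w≢w̅ , reversed
    where
    reversed : ∀ i j → i < j → OccursAt u (reverse w) i → OccursAt u (reverse w) j →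
      Σ ℕ λ m → i < m × m < j × OccursAt u w m
    reversed i j i<j occ-i occ-j
      with m , i<m , m<j , occ-m ← reverse-between tzero (reverse w) (λ w̅≡w̅̅ → w≢w̅ (reverse-injective w̅≡w̅̅)) i j i<j occ-i occ-j
      = m , i<m , m<j , subst (λ x → OccursAt u x m) (reverse-involutive w) occ-m

corollary13 : ∀ {k} (u : Word k) → Aperiodic u → ClosedUnderReversal u →
    (N : ℕ) → (∀ n → n ≥ N → TZeroAt u n) →
    ∀ {n} (w : Vec (Fin k) n) → n ≥ N → Factor u w → w ≢ reverse w →
    (∀ i j → i < j → OccursAt u w i → OccursAt u w j →
      Σ ℕ λ m → i < m × m < j × OccursAt u (reverse w) m)
    × (∀ i j → i < j → OccursAt u (reverse w) i → OccursAt u (reverse w) j →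
      Σ ℕ λ m → i < m × m < j × OccursAt u w m)
corollary13 u _ closed N tzero {n} w n≥N _ w≢w̅ = Rauzy.alternation u closed n (tzero n n≥N) w w≢w̅
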